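{- Let $k\geq 2$ and $n$ be integers with $n\geq 2k+1$ and $n\geq 12$. Let $G$ be an edge-colored graph obtained from the complete graph $K_n$ by deleting at most one edge, and let $G^r$ be a spanning subgraph of $G$ obtained by selecting exactly one edge from each color class of $G$ (so $G^r$ is rainbow and $e(G^r)$ equals the number of colors of $G$). Suppose that $G^r\cong K_{2k-3}\cup K_3\cup \overline{K_{n-2k}}$. Then $G$ contains a rainbow matching of size $k$.
   Context: All graphs are simple and finite. An edge-colored graph has a color assigned to each edge (not necessarily proper). A color class is the set of edges receiving a given color. A subgraph is rainbow if all its edges have distinct colors. A matching of size $k$ is a set of $k$ pairwise vertex-disjoint edges. $K_m$ is the complete graph on $m$ vertices, $\overline{K_m}$ is the edgeless graph on $m$ vertices, and $\cup$ denotes vertex-disjoint union of graphs. -}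

module Defs where

open import Data.Nat using (ℕ; _<_; _≤_; _*_; _∸_; _<?_)
open import Data.Unit using (⊤)
open import Data.Fin using (Fin; toℕ)
open import Data.Maybe using (Maybe; just; nothing)
open import Data.Product using (_×_; _,_; Σ; ∃)
open import Data.Sum using (_⊎_)
open import Data.Empty using (⊥)
open import Relation.Nullary using (¬_; yes; no)
open import Relation.Binary.PropositionalEquality using (_≡_; _≢_)
open import Function.Bundles using (_↔_; Inverse)

Rel : ℕ → Set₁
Rel n = Fin n → Fin n → Set

SamePair : {n : ℕ} → Fin n → Fin n → Fin n → Fin n → Set
SamePair u v x y = (u ≡ x × v ≡ y) ⊎ (u ≡ y × v ≡ x)

-- K_n with at most one edge deleted: 'nothing' = no edge deleted,
-- 'just (a , b)' (with a ≢ b) = the edge {a,b} deleted.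
KminusEdge : (n : ℕ) → Maybe (Fin n × Fin n) → Rel n
KminusEdge n nothing u v = u ≢ v
KminusEdge n (just (a , b)) u v = u ≢ v × ¬ SamePair u v a b

ValidDeletion : (n : ℕ) → Maybe (Fin n × Fin n) → Set
ValidDeletion n nothing = ⊤
ValidDeletion n (just (a , b)) = a ≢ b

-- An edge colouring of a graph on Fin n: a symmetric map on ordered pairs
-- (its values on non-edges are irrelevant).
SymColouring : (n : ℕ) → (Fin n → Fin n → ℕ) → Set
SymColouring n c = ∀ u v → c u v ≡ c v u

RainbowRepresentative : {n : ℕ} → Rel n → (Fin n → Fin n → ℕ) → Rel n → Set
RainbowRepresentative {n} G c R =
  (∀ u v → R u v → R v u) ×
  (∀ u v → R u v → G u v) ×
  (∀ u v → G u v → ∃ λ x → ∃ λ y → R x y × c x y ≡ c u v) ×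
  (∀ u v x y → R u v → R x y → c u v ≡ c x y → SamePair u v x y)

-- The graph K_{2k-3} ∪ K_3 ∪ \overline{K_{n-2k}} on Fin n (for n ≥ 2k, k ≥ 2):
-- vertices with index < 2k-3 form the K_{2k-3}, indices 2k-3, 2k-2, 2k-1
-- form the K_3, and the remaining n-2k vertices are isolated.
block : (k : ℕ) → {n : ℕ} → Fin n → ℕ
block k v with toℕ v <? (2 * k ∸ 3)
... | yes _ = 0
... | no _ with toℕ v <? (2 * k)
...   | yes _ = 1
...   | no _ = 2

CliquesGraph : (k n : ℕ) → Rel n
CliquesGraph k n u v = u ≢ v × block k u ≡ block k v × block k u < 2

Isomorphic : {n : ℕ} → Rel n → Rel n → Set
Isomorphic {n} R H =
  Σ (Fin n ↔ Fin n) λ σ → ∀ u v →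
    (R u v → H (Inverse.to σ u) (Inverse.to σ v)) ×
    (H (Inverse.to σ u) (Inverse.to σ v) → R u v)

RainbowMatching : {n : ℕ} → Rel n → (Fin n → Fin n → ℕ) → ℕ → Set
RainbowMatching {n} G c k =
  Σ (Fin k → Fin n) λ a → Σ (Fin k → Fin n) λ b →
    (∀ i → G (a i) (b i)) ×
    (∀ i j → i ≢ j →
       (a i ≢ a j × a i ≢ b j × b i ≢ a j × b i ≢ b j) ×
       c (a i) (b i) ≢ c (a j) (b j))

{-# OPTIONS --safe #-}
module Submission where

-- Through the isomorphism, number the vertices so that R is a clique on the positions [0, a), a = 2k − 3,
-- a triangle on [a, a + 3), and isolated beyond. The edges of R have pairwise distinct colours, so for
-- an edge xy of G the colour c(xy) is carried by at most one edge of R; hence of two matchings of size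
-- k − 1 in R − {x, y} without a common edge, one avoids that colour and extends by xy to a rainbow
-- matching of size k. Both matchings use one triangle edge and k − 2 clique edges: the first joins only
-- consecutive positions (a, a + 1 and 2t + o, 2t + o + 1), the second none (a, a + 2 and t + o, t + o + L).
-- As K_n minus one edge contains one of any two edges at a vertex, xy can be chosen from the first
-- isolated vertex x = a + 3 either to another isolated vertex, when there are three of them, or, when
-- k ≥ 4, to an end of the clique, the other 2k − 4 clique vertices forming the window [o, o + 2k − 4).

open import Defs
open import Data.Nat using (ℕ; zero; suc; _≤_; _<_; _*_; _+_; _∸_; _%_; NonZero; >-nonZero; z≤n; s≤s)
open import Data.Nat.Properties
open import Data.Nat.DivMod using (_mod_; m<n⇒m%n≡m)
open import Data.Fin using (Fin; zero; suc; toℕ)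
open import Data.Fin.Properties using (toℕ-injective; toℕ<n; toℕ-fromℕ<; any?) renaming (_≟_ to _≟ᶠ_)
open import Data.Maybe using (Maybe; just; nothing)
open import Data.Product using (_×_; Σ-syntax; _,_; proj₁; proj₂; map)
open import Data.Sum using (_⊎_; inj₁; inj₂; [_,_]) renaming (map to map⊎)
open import Function using (_∘_)
open import Function.Bundles using (_↔_; Inverse)
open import Relation.Binary.PropositionalEquality using (_≡_; _≢_; refl; sym; trans; cong; subst; subst₂; module ≡-Reasoning)
open import Relation.Nullary using (¬_; yes; no; contradiction)
open import Relation.Nullary.Decidable using (_×-dec_; _⊎-dec_)

Disjoint : {V : Set} → V → V → V → V → Set
Disjoint u v x y = u ≢ x × u ≢ y × v ≢ x × v ≢ y

SameEdge : {V : Set} → V → V → V → V → Set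
SameEdge u v x y = (u ≡ x × v ≡ y) ⊎ (u ≡ y × v ≡ x)

Disjoint-sym : {V : Set} {u v x y : V} → Disjoint u v x y → Disjoint x y u v
Disjoint-sym (u≢x , u≢y , v≢x , v≢y) = u≢x ∘ sym , v≢x ∘ sym , u≢y ∘ sym , v≢y ∘ sym

record Matching {V : Set} (H : V → V → Set) (m : ℕ) : Set where
  field
    left right : Fin m → V
    edge       : ∀ i → H (left i) (right i)
    disjoint   : ∀ i j → i ≢ j → Disjoint (left i) (right i) (left j) (right j)

open Matching

module _ {V : Set} {H : V → V → Set} {m : ℕ} where

  Avoids : V → V → Matching H m → Set
  Avoids x y M = ∀ i → Disjoint x y (left M i) (right M i)

  Within : (V → Set) → Matching H m → Set
  Within S M = ∀ i → S (left M i) × S (right M i)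

  ShareNoEdge : Matching H m → Matching H m → Set
  ShareNoEdge M₁ M₂ = ∀ i j → ¬ SameEdge (left M₁ i) (right M₁ i) (left M₂ j) (right M₂ j)

  colour : (V → V → ℕ) → Matching H m → Fin m → ℕ
  colour c M i = c (left M i) (right M i)

  Rainbow : (V → V → ℕ) → Matching H m → Set
  Rainbow c M = ∀ i j → i ≢ j → colour c M i ≢ colour c M j

  within⇒avoids : ∀ {S x y} (M : Matching H m) → Within S M → ¬ S x → ¬ S y → Avoids x y M
  within⇒avoids {S} M inS x∉S y∉S i =
    ∉⇒≢ x∉S (proj₁ (inS i)) , ∉⇒≢ x∉S (proj₂ (inS i)) ,
    ∉⇒≢ y∉S (proj₁ (inS i)) , ∉⇒≢ y∉S (proj₂ (inS i))
    where
    ∉⇒≢ : ∀ {u v} → ¬ S u → S v → u ≢ v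
    ∉⇒≢ u∉S v∈S refl = u∉S v∈S

  within-mono : ∀ {S S′} (M : Matching H m) → (∀ {p} → S p → S′ p) → Within S M → Within S′ M
  within-mono M S⊆S′ inS i = S⊆S′ (proj₁ (inS i)) , S⊆S′ (proj₂ (inS i))

  weaken : {K : V → V → Set} → (∀ {u v} → H u v → K u v) → Matching H m → Matching K m
  weaken H⊆K M = record { left = left M ; right = right M ; edge = H⊆K ∘ edge M ; disjoint = disjoint M }

  cons : ∀ {x y} → H x y → (M : Matching H m) → Avoids x y M → Matching H (suc m)
  cons {x} {y} xy M avoid = record { left = l ; right = r ; edge = e ; disjoint = d }
    where
    l r : Fin (suc m) → V
    l zero    = x
    l (suc i) = left M i
    r zero    = y
    r (suc i) = right M i
    e : ∀ i → H (l i) (r i)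
    e zero    = xy
    e (suc i) = edge M i
    d : ∀ i j → i ≢ j → Disjoint (l i) (r i) (l j) (r j)
    d zero    zero    0≢0 = contradiction refl 0≢0
    d zero    (suc j) _   = avoid j
    d (suc i) zero    _   = Disjoint-sym (avoid i)
    d (suc i) (suc j) i≢j = disjoint M i j (i≢j ∘ cong suc)

module _ {V : Set} {G H : V → V → Set} {c : V → V → ℕ}
         (H⊆G : ∀ {u v} → H u v → G u v)
         (unique : ∀ {u v x y} → H u v → H x y → c u v ≡ c x y → SameEdge u v x y) where

  matching-rainbow : ∀ {m} (M : Matching H m) → Rainbow c M
  matching-rainbow M i j i≢j same with unique (edge M i) (edge M j) same
  ... | inj₁ (lᵢ≡lⱼ , _) = proj₁ (disjoint M i j i≢j) lᵢ≡lⱼ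
  ... | inj₂ (lᵢ≡rⱼ , _) = proj₁ (proj₂ (disjoint M i j i≢j)) lᵢ≡rⱼ

  cons-rainbow : ∀ {m x y} → G x y → (M : Matching H m) → Avoids x y M →
                 (∀ i → c x y ≢ colour c M i) → Σ[ M′ ∈ Matching G (suc m) ] Rainbow c M′
  cons-rainbow xy M avoid fresh = cons xy (weaken H⊆G M) avoid , rainbow
    where
    rainbow : Rainbow c (cons xy (weaken H⊆G M) avoid)
    rainbow zero    zero    0≢0 = contradiction refl 0≢0
    rainbow zero    (suc j) _   = fresh j
    rainbow (suc i) zero    _   = fresh i ∘ sym
    rainbow (suc i) (suc j) i≢j = matching-rainbow M i j (i≢j ∘ cong suc)

  -- The colour of xy is the colour of at most one edge of H, and that edge lies in at most one of M₁, M₂.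
  cons-rainbow-one-of : ∀ {m x y} → G x y → (M₁ M₂ : Matching H m) →
                        Avoids x y M₁ → Avoids x y M₂ → ShareNoEdge M₁ M₂ →
                        Σ[ M ∈ Matching G (suc m) ] Rainbow c M
  cons-rainbow-one-of {x = x} {y} xy M₁ M₂ avoid₁ avoid₂ noShared
    with any? (λ i → c x y ≟ colour c M₁ i)
  ... | no fresh₁ = cons-rainbow xy M₁ avoid₁ (λ i eq → fresh₁ (i , eq))
  ... | yes (i , eq₁) = cons-rainbow xy M₂ avoid₂ λ j eq₂ →
          noShared i j (unique (edge M₁ i) (edge M₂ j) (trans (sym eq₁) eq₂))

shareNoEdge-by-length : ∀ {H : ℕ → ℕ → Set} {m} (M₁ M₂ : Matching H m) →
                         (∀ i → right M₁ i ≡ suc (left M₁ i)) → (∀ j → 2 + left M₂ j ≤ right M₂ j) →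
                         ShareNoEdge M₁ M₂
shareNoEdge-by-length M₁ M₂ short long i j (inj₁ (l≡l , r≡r)) =
  1+n≰n (subst (2 + left M₂ j ≤_) (trans (sym r≡r) (trans (short i) (cong suc l≡l))) (long j))
shareNoEdge-by-length M₁ M₂ short long i j (inj₂ (l≡r , r≡l)) =
  m+n≮n 2 (right M₂ j)
    (subst (_≤ right M₂ j) (cong (2 +_) (trans (sym r≡l) (trans (short i) (cong suc l≡r)))) (long j))

1+2m<2n : ∀ {m n} → m < n → 1 + 2 * m < 2 * n
1+2m<2n {m} {n} m<n = subst (_≤ 2 * n) (*-suc 2 m) (*-monoʳ-≤ 2 m<n)

o+t<L+[o+t′] : ∀ o {L t} t′ → t < L → o + t < L + (o + t′)
o+t<L+[o+t′] o {L} t′ t<L =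
  <-≤-trans (+-monoʳ-< o t<L) (≤-trans (≤-reflexive (+-comm o L)) (+-monoʳ-≤ L (m≤m+n o t′)))

consecutive-pairs-disjoint : ∀ o {t t′} → t ≢ t′ →
  Disjoint (o + 2 * t) (suc (o + 2 * t)) (o + 2 * t′) (suc (o + 2 * t′))
consecutive-pairs-disjoint o {t} {t′} t≢t′ =
  evens , parity {t} {t′} , parity {t′} {t} ∘ sym , evens ∘ suc-injective
  where
  evens : o + 2 * t ≢ o + 2 * t′
  evens = t≢t′ ∘ *-cancelˡ-≡ t t′ 2 ∘ +-cancelˡ-≡ o (2 * t) (2 * t′)
  parity : ∀ {u v} → o + 2 * u ≢ suc (o + 2 * v)
  parity {u} {v} eq = even≢odd u v (+-cancelˡ-≡ o (2 * u) (suc (2 * v)) (trans eq (sym (+-suc o (2 * v)))))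

infix 4 _∈[_,_⟩
_∈[_,_⟩ : ℕ → ℕ → ℕ → Set
p ∈[ lo , hi ⟩ = lo ≤ p × p < hi

∉-range : ∀ {p lo hi} → p < lo ⊎ hi ≤ p → ¬ p ∈[ lo , hi ⟩
∉-range (inj₁ p<lo) (lo≤p , _) = <⇒≱ p<lo lo≤p
∉-range (inj₂ hi≤p) (_ , p<hi) = <⇒≱ p<hi hi≤p

Cliquesℕ : ℕ → ℕ → ℕ → Set
Cliquesℕ a p q = p ≢ q × (p < a × q < a ⊎ p ∈[ a , 3 + a ⟩ × q ∈[ a , 3 + a ⟩)

module PositionMatchings (m : ℕ) where

  a : ℕ
  a = suc (2 * m)

  Support : ℕ → ℕ → ℕ → Set
  Support lo hi p = p ∈[ lo , hi ⟩ ⊎ p ∈[ a , 3 + a ⟩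

  outside-support : ∀ {lo hi p} → p < lo ⊎ hi ≤ p → p < a ⊎ 3 + a ≤ p → ¬ Support lo hi p
  outside-support ∉A ∉T = [ ∉-range ∉A , ∉-range ∉T ]

  above-support : ∀ {lo hi p} → hi ≤ a → 3 + a ≤ p → ¬ Support lo hi p
  above-support hi≤a 3+a≤p = outside-support (inj₂ (≤-trans hi≤a (≤-trans (m≤n+m a 3) 3+a≤p))) (inj₂ 3+a≤p)

  private
    clique-edge : ∀ {lo hi p q} → hi ≤ a → p ≢ q → p ∈[ lo , hi ⟩ → q ∈[ lo , hi ⟩ → Cliquesℕ a p q
    clique-edge hi≤a p≢q (_ , p<hi) (_ , q<hi) = p≢q , inj₁ (<-≤-trans p<hi hi≤a , <-≤-trans q<hi hi≤a)

    avoids-triangle : ∀ (M : Matching (Cliquesℕ a) m) {lo hi} → hi ≤ a → Within (_∈[ lo , hi ⟩) M →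
                      ∀ {x y} → a ≤ x → a ≤ y → Avoids x y M
    avoids-triangle M {lo} {hi} hi≤a inWindow a≤x a≤y =
      within⇒avoids {S = _< a} M below-a (≤⇒≯ a≤x) (≤⇒≯ a≤y)
      where
      below-a : Within (_< a) M
      below-a = within-mono {S = _∈[ lo , hi ⟩} M (λ (_ , p<hi) → <-≤-trans p<hi hi≤a) inWindow

  shortPairs-left∈ : ∀ o {t} → t < m → o + 2 * t ∈[ o , o + 2 * m ⟩
  shortPairs-left∈ o t<m = m≤m+n o _ , +-monoʳ-< o (<-trans (n<1+n _) (1+2m<2n t<m))

  shortPairs-right∈ : ∀ o {t} → t < m → suc (o + 2 * t) ∈[ o , o + 2 * m ⟩
  shortPairs-right∈ o t<m = m≤n⇒m≤1+n (m≤m+n o _) , subst (_< o + 2 * m) (+-suc o _) (+-monoʳ-< o (1+2m<2n t<m))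

  longPairs-left∈ : ∀ o {L t} → m ≤ L → t < m → o + t ∈[ o , L + (o + m) ⟩
  longPairs-left∈ o m≤L t<m = m≤m+n o _ , o+t<L+[o+t′] o m (<-≤-trans t<m m≤L)

  longPairs-right∈ : ∀ o L {t} → t < m → L + (o + t) ∈[ o , L + (o + m) ⟩
  longPairs-right∈ o L t<m = ≤-trans (m≤m+n o _) (m≤n+m _ L) , +-monoʳ-< L (+-monoʳ-< o t<m)

  shortPairs : ∀ o → o ≤ 1 → Matching (Cliquesℕ a) m
  shortPairs o o≤1 = record
    { left     = λ t → o + 2 * toℕ t
    ; right    = λ t → suc (o + 2 * toℕ t)
    ; edge     = λ t → clique-edge (+-monoˡ-≤ (2 * m) o≤1) (1+n≢n ∘ sym)
                                   (shortPairs-left∈ o (toℕ<n t)) (shortPairs-right∈ o (toℕ<n t))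
    ; disjoint = λ t t′ t≢t′ → consecutive-pairs-disjoint o (t≢t′ ∘ toℕ-injective)
    }

  longPairs : ∀ o L → m ≤ L → L + (o + m) ≤ a → Matching (Cliquesℕ a) m
  longPairs o L m≤L fits = record
    { left     = λ t → o + toℕ t
    ; right    = λ t → L + (o + toℕ t)
    ; edge     = λ t → clique-edge fits (<⇒≢ (o+t<L+[o+t′] o (toℕ t) (t<L t)))
                                   (longPairs-left∈ o m≤L (toℕ<n t)) (longPairs-right∈ o L (toℕ<n t))
    ; disjoint = λ t t′ t≢t′ →
        t≢t′ ∘ toℕ-injective ∘ +-cancelˡ-≡ o _ _ ,
        <⇒≢ (o+t<L+[o+t′] o (toℕ t′) (t<L t)) ,
        >⇒≢ (o+t<L+[o+t′] o (toℕ t) (t<L t′)) ,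
        t≢t′ ∘ toℕ-injective ∘ +-cancelˡ-≡ o _ _ ∘ +-cancelˡ-≡ L _ _
    }
    where
    t<L : (t : Fin m) → toℕ t < L
    t<L t = <-≤-trans (toℕ<n t) m≤L

  shortPairs-window : ∀ o (o≤1 : o ≤ 1) → Within (_∈[ o , o + 2 * m ⟩) (shortPairs o o≤1)
  shortPairs-window o o≤1 t = shortPairs-left∈ o (toℕ<n t) , shortPairs-right∈ o (toℕ<n t)

  longPairs-window : ∀ o L (m≤L : m ≤ L) (fits : L + (o + m) ≤ a) →
                     Within (_∈[ o , L + (o + m) ⟩) (longPairs o L m≤L fits)
  longPairs-window o L m≤L fits t = longPairs-left∈ o m≤L (toℕ<n t) , longPairs-right∈ o L (toℕ<n t)

  triangle∈ : ∀ {j} → j < 3 → j + a ∈[ a , 3 + a ⟩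
  triangle∈ {j} j<3 = m≤n+m a j , +-monoˡ-< a j<3

  T₀∈ : a ∈[ a , 3 + a ⟩
  T₀∈ = triangle∈ {0} (s≤s z≤n)

  T₁∈ : 1 + a ∈[ a , 3 + a ⟩
  T₁∈ = triangle∈ {1} (s≤s (s≤s z≤n))

  T₂∈ : 2 + a ∈[ a , 3 + a ⟩
  T₂∈ = triangle∈ {2} (s≤s (s≤s (s≤s z≤n)))

  short : ∀ o → o ≤ 1 → Matching (Cliquesℕ a) (suc m)
  short o o≤1 = cons {x = a} (1+n≢n ∘ sym , inj₂ (T₀∈ , T₁∈)) (shortPairs o o≤1)
    (avoids-triangle (shortPairs o o≤1) (+-monoˡ-≤ (2 * m) o≤1) (shortPairs-window o o≤1) ≤-refl (n≤1+n a))

  long : ∀ o L (m≤L : m ≤ L) (fits : L + (o + m) ≤ a) → Matching (Cliquesℕ a) (suc m)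
  long o L m≤L fits = cons (<⇒≢ (m<n+m a {2} (s≤s z≤n)) , inj₂ (T₀∈ , T₂∈)) (longPairs o L m≤L fits)
    (avoids-triangle (longPairs o L m≤L fits) fits (longPairs-window o L m≤L fits) ≤-refl (m≤n+m a 2))

  short-within : ∀ o (o≤1 : o ≤ 1) → Within (Support o (o + 2 * m)) (short o o≤1)
  short-within o o≤1 zero    = inj₂ T₀∈ , inj₂ T₁∈
  short-within o o≤1 (suc t) = map inj₁ inj₁ (shortPairs-window o o≤1 t)

  long-within : ∀ o L (m≤L : m ≤ L) (fits : L + (o + m) ≤ a) →
                Within (Support o (L + (o + m))) (long o L m≤L fits)
  long-within o L m≤L fits zero    = inj₂ T₀∈ , inj₂ T₂∈
  long-within o L m≤L fits (suc t) = map inj₁ inj₁ (longPairs-window o L m≤L fits t)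

  short-long-shareNoEdge : ∀ o (o≤1 : o ≤ 1) o′ L (m≤L : m ≤ L) (fits : L + (o′ + m) ≤ a) →
                           (0 < m → 1 < L) → ShareNoEdge (short o o≤1) (long o′ L m≤L fits)
  short-long-shareNoEdge o o≤1 o′ L m≤L fits 1<L =
    shareNoEdge-by-length (short o o≤1) (long o′ L m≤L fits) unit-length long-length
    where
    unit-length : ∀ i → right (short o o≤1) i ≡ suc (left (short o o≤1) i)
    unit-length zero    = refl
    unit-length (suc t) = refl
    long-length : ∀ j → 2 + left (long o′ L m≤L fits) j ≤ right (long o′ L m≤L fits) j
    long-length zero    = ≤-refl
    long-length (suc t) = +-monoˡ-≤ (o′ + toℕ t) (1<L (<-≤-trans (s≤s z≤n) (toℕ<n t)))

2*m≡m+m : ∀ m → 2 * m ≡ m + m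
2*m≡m+m m = cong (m +_) (*-identityˡ m)

2*[2+m]≡4+2*m : ∀ m → 2 * (2 + m) ≡ 4 + 2 * m
2*[2+m]≡4+2*m m = trans (*-suc 2 (suc m)) (cong (2 +_) (*-suc 2 m))

2*[2+m]∸3≡1+2*m : ∀ m → 2 * (2 + m) ∸ 3 ≡ suc (2 * m)
2*[2+m]∸3≡1+2*m m = cong (_∸ 3) (2*[2+m]≡4+2*m m)

block-clique : ∀ k {n} (v : Fin n) → toℕ v < 2 * k ∸ 3 → block k v ≡ 0
block-clique k v v<2k-3 with toℕ v <? 2 * k ∸ 3
... | yes _ = refl
... | no v≮2k-3 = contradiction v<2k-3 v≮2k-3

block-triangle : ∀ k {n} (v : Fin n) → 2 * k ∸ 3 ≤ toℕ v → toℕ v < 2 * k → block k v ≡ 1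
block-triangle k v 2k-3≤v v<2k with toℕ v <? 2 * k ∸ 3
... | yes v<2k-3 = contradiction 2k-3≤v (<⇒≱ v<2k-3)
... | no _ with toℕ v <? 2 * k
...   | yes _ = refl
...   | no v≮2k = contradiction v<2k v≮2k

Cliquesℕ-bounded : ∀ {a p q} → Cliquesℕ a p q → p < 3 + a × q < 3 + a
Cliquesℕ-bounded {a} (_ , inj₁ (p<a , q<a)) = <-≤-trans p<a (m≤n+m a 3) , <-≤-trans q<a (m≤n+m a 3)
Cliquesℕ-bounded (_ , inj₂ ((_ , p<3+a) , (_ , q<3+a))) = p<3+a , q<3+a

Cliquesℕ⇒CliquesGraph : ∀ m {n} {u v : Fin n} →
                        Cliquesℕ (suc (2 * m)) (toℕ u) (toℕ v) → CliquesGraph (2 + m) n u v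
Cliquesℕ⇒CliquesGraph m {u = u} {v} (u≢v , inj₁ (u<a , v<a)) =
  same-block (s≤s z≤n) (in-clique u u<a) (in-clique v v<a)
  where
  in-clique : ∀ w → toℕ w < suc (2 * m) → block (2 + m) w ≡ 0
  in-clique w w<a = block-clique (2 + m) w (subst (toℕ w <_) (sym (2*[2+m]∸3≡1+2*m m)) w<a)
  same-block : ∀ {j} → j < 2 → block (2 + m) u ≡ j → block (2 + m) v ≡ j → CliquesGraph (2 + m) _ u v
  same-block j<2 bu bv = u≢v ∘ cong toℕ , trans bu (sym bv) , subst (_< 2) (sym bu) j<2
Cliquesℕ⇒CliquesGraph m {u = u} {v} (u≢v , inj₂ (u∈T , v∈T)) =
  same-block (s≤s (s≤s z≤n)) (in-triangle u u∈T) (in-triangle v v∈T)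
  where
  in-triangle : ∀ w → toℕ w ∈[ suc (2 * m) , 3 + suc (2 * m) ⟩ → block (2 + m) w ≡ 1
  in-triangle w (a≤w , w<3+a) = block-triangle (2 + m) w
    (subst (_≤ toℕ w) (sym (2*[2+m]∸3≡1+2*m m)) a≤w)
    (subst (toℕ w <_) (sym (2*[2+m]≡4+2*m m)) w<3+a)
  same-block : ∀ {j} → j < 2 → block (2 + m) u ≡ j → block (2 + m) v ≡ j → CliquesGraph (2 + m) _ u v
  same-block j<2 bu bv = u≢v ∘ cong toℕ , trans bu (sym bv) , subst (_< 2) (sym bu) j<2

SamePair-one-of : ∀ {n} {u v w a b : Fin n} → u ≢ v → SamePair u v a b → SamePair u w a b → v ≡ w
SamePair-one-of u≢v (inj₁ (refl , refl)) (inj₁ (refl , refl)) = refl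
SamePair-one-of u≢v (inj₁ (refl , refl)) (inj₂ (refl , refl)) = contradiction refl u≢v
SamePair-one-of u≢v (inj₂ (refl , refl)) (inj₁ (refl , refl)) = contradiction refl u≢v
SamePair-one-of u≢v (inj₂ (refl , refl)) (inj₂ (refl , refl)) = refl

KminusEdge-one-of : ∀ {n} d {u v w : Fin n} → u ≢ v → u ≢ w → v ≢ w →
                    KminusEdge n d u v ⊎ KminusEdge n d u w
KminusEdge-one-of nothing u≢v _ _ = inj₁ u≢v
KminusEdge-one-of (just (a , b)) {u} {v} u≢v u≢w v≢w
  with ((u ≟ᶠ a) ×-dec (v ≟ᶠ b)) ⊎-dec ((u ≟ᶠ b) ×-dec (v ≟ᶠ a))
... | no uv≠ab = inj₁ (u≢v , uv≠ab)
... | yes uv=ab = inj₂ (u≢w , v≢w ∘ SamePair-one-of u≢v uv=ab)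

module Positions {n : ℕ} .{{_ : NonZero n}} (σ : Fin n ↔ Fin n) where
  open Inverse σ

  -- Only positions p < n are meaningful: beyond them p mod n wraps around.
  vertex : ℕ → Fin n
  vertex p = from (p mod n)

  toℕ-to-vertex : ∀ {p} → p < n → toℕ (to (vertex p)) ≡ p
  toℕ-to-vertex {p} p<n = begin
    toℕ (to (from (p mod n))) ≡⟨ cong toℕ (strictlyInverseˡ (p mod n)) ⟩
    toℕ (p mod n)             ≡⟨ toℕ-fromℕ< _ ⟩
    p % n                     ≡⟨ m<n⇒m%n≡m p<n ⟩
    p                         ∎
    where open ≡-Reasoning

  vertex-injective : ∀ {p q} → p < n → q < n → vertex p ≡ vertex q → p ≡ q
  vertex-injective p<n q<n eq = trans (sym (toℕ-to-vertex p<n)) (trans (cong (toℕ ∘ to) eq) (toℕ-to-vertex q<n))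

  Pullback : Rel n → ℕ → ℕ → Set
  Pullback G p q = p < n × q < n × G (vertex p) (vertex q)

  pullbackColouring : (Fin n → Fin n → ℕ) → ℕ → ℕ → ℕ
  pullbackColouring c p q = c (vertex p) (vertex q)

  pushforward : ∀ {G c k} → Σ[ M ∈ Matching (Pullback G) k ] Rainbow (pullbackColouring c) M →
                RainbowMatching G c k
  pushforward {G} (M , rainbow) =
    vertex ∘ left M , vertex ∘ right M , proj₂ ∘ proj₂ ∘ edge M ,
    λ i j i≢j → vertex-disjoint {G} (edge M i) (edge M j) (disjoint M i j i≢j) , rainbow i j i≢j
    where
    vertex-disjoint : ∀ {G : Rel n} {p q p′ q′} → Pullback G p q → Pullback G p′ q′ →
                      Disjoint p q p′ q′ → Disjoint (vertex p) (vertex q) (vertex p′) (vertex q′)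
    vertex-disjoint (p<n , q<n , _) (p′<n , q′<n , _) (p≢p′ , p≢q′ , q≢p′ , q≢q′) =
      p≢p′ ∘ vertex-injective p<n p′<n , p≢q′ ∘ vertex-injective p<n q′<n ,
      q≢p′ ∘ vertex-injective q<n p′<n , q≢q′ ∘ vertex-injective q<n q′<n

  pullback-unique : ∀ {R : Rel n} {c} → (∀ u v x y → R u v → R x y → c u v ≡ c x y → SamePair u v x y) →
                    ∀ {p q p′ q′} → Pullback R p q → Pullback R p′ q′ →
                    pullbackColouring c p q ≡ pullbackColouring c p′ q′ → SameEdge p q p′ q′
  pullback-unique unique (p<n , q<n , pq) (p′<n , q′<n , p′q′) same =
    map⊎ (map (vertex-injective p<n p′<n) (vertex-injective q<n q′<n))
         (map (vertex-injective p<n q′<n) (vertex-injective q<n p′<n))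
         (unique _ _ _ _ pq p′q′ same)

  KminusEdge-pullback-one-of : ∀ d {x y z} → x < n → y < n → z < n → x ≢ y → x ≢ z → y ≢ z →
                               Pullback (KminusEdge n d) x y ⊎ Pullback (KminusEdge n d) x z
  KminusEdge-pullback-one-of d x<n y<n z<n x≢y x≢z y≢z =
    map⊎ (λ xy → x<n , y<n , xy) (λ xz → x<n , z<n , xz)
      (KminusEdge-one-of d (x≢y ∘ vertex-injective x<n y<n) (x≢z ∘ vertex-injective x<n z<n)
                           (y≢z ∘ vertex-injective y<n z<n))

  Cliquesℕ⊆Pullback : ∀ {m} {R : Rel n} → (∀ u v → CliquesGraph (2 + m) n (to u) (to v) → R u v) →
                      3 + suc (2 * m) ≤ n → ∀ {p q} → Cliquesℕ (suc (2 * m)) p q → Pullback R p q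
  Cliquesℕ⊆Pullback {m} fromCliques 3+a≤n pq =
    p<n , q<n , fromCliques _ _ (Cliquesℕ⇒CliquesGraph m
      (subst₂ (Cliquesℕ (suc (2 * m))) (sym (toℕ-to-vertex p<n)) (sym (toℕ-to-vertex q<n)) pq))
    where
    p<n = <-≤-trans (proj₁ (Cliquesℕ-bounded pq)) 3+a≤n
    q<n = <-≤-trans (proj₂ (Cliquesℕ-bounded pq)) 3+a≤n

module Construction {m n : ℕ} .{{_ : NonZero n}}
  {d : Maybe (Fin n × Fin n)} {c : Fin n → Fin n → ℕ} {R : Rel n}
  (R⊆G : ∀ u v → R u v → KminusEdge n d u v)
  (unique : ∀ u v x y → R u v → R x y → c u v ≡ c x y → SamePair u v x y)
  (σ : Fin n ↔ Fin n)
  (fromCliques : ∀ u v → CliquesGraph (2 + m) n (Inverse.to σ u) (Inverse.to σ v) → R u v)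
  (one-isolated : 4 + suc (2 * m) ≤ n) where

  open Positions σ
  open PositionMatchings m

  private
    G : Rel n
    G = KminusEdge n d

    x : ℕ
    x = 3 + a

    Cliquesℕ⊆PullbackR : ∀ {p q} → Cliquesℕ a p q → Pullback R p q
    Cliquesℕ⊆PullbackR = Cliquesℕ⊆Pullback {m} fromCliques (≤-trans (n≤1+n _) one-isolated)

  extend : ∀ {x y} → Pullback G x y → (M₁ M₂ : Matching (Cliquesℕ a) (suc m)) →
           Avoids x y M₁ → Avoids x y M₂ → ShareNoEdge M₁ M₂ → RainbowMatching G c (2 + m)
  extend xy M₁ M₂ avoid₁ avoid₂ noShared =
    pushforward {G} {c} (cons-rainbow-one-of H⊆G unique′ xy M₁ M₂ avoid₁ avoid₂ noShared)
    where
    H⊆G : ∀ {p q} → Cliquesℕ a p q → Pullback G p q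
    H⊆G pq = let (p<n , q<n , R-pq) = Cliquesℕ⊆PullbackR pq in p<n , q<n , R⊆G _ _ R-pq
    unique′ : ∀ {p q p′ q′} → Cliquesℕ a p q → Cliquesℕ a p′ q′ →
              pullbackColouring c p q ≡ pullbackColouring c p′ q′ → SameEdge p q p′ q′
    unique′ pq p′q′ = pullback-unique unique (Cliquesℕ⊆PullbackR pq) (Cliquesℕ⊆PullbackR p′q′)

  with-three-isolated : 6 + a ≤ n → RainbowMatching G c (2 + m)
  with-three-isolated 6+a≤n =
    [ from-isolated (n≤1+n x) , from-isolated (m≤n+m x 2) ]
      (KminusEdge-pullback-one-of d one-isolated (≤-trans (n≤1+n _) 6+a≤n) 6+a≤n
        (<⇒≢ (n<1+n x)) (<⇒≢ (m<n+m x {2} (s≤s z≤n))) (<⇒≢ (n<1+n (suc x))))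
    where
    fits : suc m + (0 + m) ≤ a
    fits = s≤s (≤-reflexive (sym (2*m≡m+m m)))
    from-isolated : ∀ {y} → x ≤ y → Pullback G x y → RainbowMatching G c (2 + m)
    from-isolated x≤y xy = extend xy (short 0 z≤n) (long 0 (suc m) (n≤1+n m) fits)
      (within⇒avoids {S = Support 0 (2 * m)} (short 0 z≤n) (short-within 0 z≤n)
        (above-support (n≤1+n _) ≤-refl) (above-support (n≤1+n _) x≤y))
      (within⇒avoids {S = Support 0 (suc m + m)} (long 0 (suc m) (n≤1+n m) fits)
        (long-within 0 (suc m) (n≤1+n m) fits)
        (above-support fits ≤-refl) (above-support fits x≤y))
      (short-long-shareNoEdge 0 z≤n 0 (suc m) (n≤1+n m) fits s≤s)

  with-long-clique : 2 ≤ m → RainbowMatching G c (2 + m)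
  with-long-clique 2≤m =
    [ from-clique-end 1 ≤-refl (outside-support (inj₁ (s≤s z≤n)) (inj₁ (s≤s z≤n)))
                               (outside-support (inj₁ (s≤s z≤n)) (inj₁ (s≤s z≤n)))
    , from-clique-end 0 z≤n (outside-support (inj₂ ≤-refl) (inj₁ (n<1+n _)))
                            (outside-support (inj₂ (≤-reflexive (sym (2*m≡m+m m)))) (inj₁ (n<1+n _)))
    ] (KminusEdge-pullback-one-of d one-isolated (≤-trans (s≤s z≤n) one-isolated) (<-trans 2m<x one-isolated)
        (λ ()) (>⇒≢ 2m<x) (<⇒≢ (≤-trans (s≤s z≤n) (≤-trans 2≤m (m≤m+n m _)))))
    where
    2m<x : 2 * m < x
    2m<x = m<n+m (2 * m) {4} (s≤s z≤n)
    from-clique-end : ∀ o (o≤1 : o ≤ 1) {y} → ¬ Support o (o + 2 * m) y → ¬ Support o (m + (o + m)) y →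
                      Pullback G x y → RainbowMatching G c (2 + m)
    from-clique-end o o≤1 y∉short y∉long xy = extend xy (short o o≤1) (long o m ≤-refl fits)
      (within⇒avoids {S = Support o (o + 2 * m)} (short o o≤1) (short-within o o≤1)
        (above-support (+-monoˡ-≤ (2 * m) o≤1) ≤-refl) y∉short)
      (within⇒avoids {S = Support o (m + (o + m))} (long o m ≤-refl fits) (long-within o m ≤-refl fits)
        (above-support fits ≤-refl) y∉long)
      (short-long-shareNoEdge o o≤1 o m ≤-refl fits (λ _ → 2≤m))
      where
      fits : m + (o + m) ≤ a
      fits = ≤-trans (+-monoʳ-≤ m (+-monoˡ-≤ m o≤1))
                     (≤-reflexive (trans (+-suc m m) (cong suc (sym (2*m≡m+m m)))))

-- The only use of n ≥ 12: for k ≤ 3 it leaves at least three isolated vertices.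
three-isolated-or-long-clique : ∀ m {n} → 12 ≤ n → 6 + suc (2 * m) ≤ n ⊎ 2 ≤ m
three-isolated-or-long-clique zero          12≤n = inj₁ (≤-trans (m≤m+n 7 5) 12≤n)
three-isolated-or-long-clique (suc zero)    12≤n = inj₁ (≤-trans (m≤m+n 9 3) 12≤n)
three-isolated-or-long-clique (suc (suc m)) _    = inj₂ (s≤s (s≤s z≤n))

lemma3p2 : (k n : ℕ) → 2 ≤ k → 2 * k + 1 ≤ n → 12 ≤ n →
    (d : Maybe (Fin n × Fin n)) → ValidDeletion n d →
    (c : Fin n → Fin n → ℕ) → SymColouring n c →
    (R : Rel n) → RainbowRepresentative (KminusEdge n d) c R →
    Isomorphic R (CliquesGraph k n) →
    RainbowMatching (KminusEdge n d) c k
lemma3p2 (suc zero) _ (s≤s ()) _ _ _ _ _ _ _ _ _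
lemma3p2 (suc (suc m)) n _ 2k+1≤n 12≤n d _ c _ R (_ , R⊆G , _ , unique) (σ , iso) =
  [ with-three-isolated , with-long-clique ] (three-isolated-or-long-clique m 12≤n)
  where
  one-isolated : 4 + suc (2 * m) ≤ n
  one-isolated = subst (_≤ n) (trans (cong (_+ 1) (2*[2+m]≡4+2*m m)) (+-comm (4 + 2 * m) 1)) 2k+1≤n
  open Construction {m} {{>-nonZero (≤-trans (s≤s z≤n) 12≤n)}}
         R⊆G unique σ (λ u v → proj₂ (iso u v)) one-isolated
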